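{- Let $\mathcal{L}$ and $\mathcal{L}'$ be slice languages over $\Sigma^{c,q}$ such that $\mathcal{L}$ has zig-zag number $z$ and $\mathcal{L}'$ is $z$-dilated-saturated. Let $\mathcal{L}^{\cap}=\mathcal{L}\cap\mathcal{L}'$. Then $\mathcal{L}^{\cap}_{\mathcal{G}}=\mathcal{L}_{\mathcal{G}}\cap\mathcal{L}'_{\mathcal{G}}$.
   Context: A slice is $\mathbf{S}=(V,E,l,s,t,o)$ where the finite vertex set $V$ is partitioned into an in-frontier $I$, a center $C$ and an out-frontier $O$; each edge has a source and a target in $V$ (loops allowed); each vertex of $I\cup O$ is an endpoint of exactly one edge and no edge has both endpoints in the same frontier; $o:E\to\{ -1,1\}$ has $o(e)=1$ if the target of $e$ is in $O$ and $-1$ if it is in $I$; $l$ labels frontier vertices injectively within each frontier by numbers in $\{1,\dots,q\}$ and center vertices by other symbols. Its width is $\max\{|I|,|O|\}$. A unit slice has at most one center vertex; a permutation slice has empty center (including the empty slice); initial/final slices have empty in-/out-frontier. $\Sigma^{c,q}$ is the set of unit slices of width at most $c$ with frontier numbers in $\{1,\dots,q\}$. $\mathbf{S}_1$ can be glued to $\mathbf{S}_2$ if the numbers on the out-frontier of $\mathbf{S}_1$ equal those on the in-frontier of $\mathbf{S}_2$ and matched edges have equal $o$-values; gluing $\mathbf{S}_1\circ\mathbf{S}_2$ deletes these frontier vertices and fuses matched edges into consistently oriented edges. A slice language over $\Sigma^{c,q}$ is a set $\mathcal{L}$ of (formal) strings $\mathbf{S}_1\cdots\mathbf{S}_m$ over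 the alphabet $\Sigma^{c,q}$ with $\mathbf{S}_1$ initial, $\mathbf{S}_m$ final and each $\mathbf{S}_i$ gluable to $\mathbf{S}_{i+1}$; its graph language is $\mathcal{L}_{\mathcal{G}}=\{\mathbf{S}_1\circ\cdots\circ\mathbf{S}_m:\mathbf{S}_1\cdots\mathbf{S}_m\in\mathcal{L}\}$ (digraphs up to isomorphism). A unit decomposition of a digraph $H$ is such a string whose composition is $H$; it is dilated if it may contain permutation slices. For a digraph $H=(V,E)$ and $A,B\subseteq V$, $E(A,B)$ is the set of edges with one endpoint in $A$ and the other in $B$; an ordering $(v_1,\dots,v_n)$ of $V$ is $z$-topological if each directed simple path $p=(V_p,E_p)$ satisfies $|E_p\cap E(\{v_1,\dots,v_i\},\{v_{i+1},\dots,v_n\})|\leq z$ for all $i$. A dilated unit decomposition $\mathbf{S}_1\cdots\mathbf{S}_m$ of $H$ is compatible with an ordering $(v_1,\dots,v_n)$ of the vertices of $H$ if $v_i$ is the center vertex of $\mathbf{S}_{j_i}$ with $j_1<\cdots<j_n$; its zig-zag number is the least $z$ such that it is compatible with a $z$-topological ordering of $H$. The zig-zag number of a slice language is the maximal zig-zag number of its unit decompositions. A slice language $\mathcal{L}$ is $z$-dilated-saturated if it has zig-zag number at most $z$ and for every $H\in\mathcal{L}_{\mathcal{G}}$, every $z$-topological ordering $\omega$ of $H$ and every dilated unit decomposition of $H$ compatible with $\omega$, that decomposition belongs to $\mathcal{L}$. -}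

module Defs where

open import Data.Nat using (ℕ; zero; suc; _≤_; _≡ᵇ_; _<ᵇ_)
open import Data.Fin using (Fin; toℕ; zero; suc)
open import Data.Bool using (Bool; true; false; if_then_else_; _∧_; _xor_)
open import Data.Maybe using (Maybe; just; nothing; _>>=_)
open import Data.List using (List; []; _∷_; _++_; length; lookup; mapMaybe; concatMap; allFin; findIndexᵇ)
open import Data.List.Relation.Unary.All using (All)
open import Data.List.Relation.Unary.Linked using (Linked)
open import Data.Product using (Σ; ∃; _×_; _,_; proj₁; proj₂)
open import Data.Sum using (_⊎_; inj₁; inj₂)
open import Data.Empty using (⊥)
open import Relation.Nullary using (¬_; does)
open import Relation.Binary.PropositionalEquality using (_≡_; _≢_)
open import Function.Bundles using (_↔_; _⇔_; Inverse)

count : (n : ℕ) → (Fin n → Bool) → ℕ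
count zero    f = zero
count (suc n) f = if f zero then suc (count n (λ i → f (suc i))) else count n (λ i → f (suc i))

findFin : (n : ℕ) → (Fin n → Bool) → Maybe (Fin n)
findFin zero    f = nothing
findFin (suc n) f with f zero
... | true  = just zero
... | false = findFin n (λ i → f (suc i)) >>= λ i → just (suc i)

_==F_ : ∀ {n} → Fin n → Fin n → Bool
i ==F j = toℕ i ≡ᵇ toℕ j

-- the three blocks of the partition V = I ∪ C ∪ O
data Part : Set where
  inF cen outF : Part

_==P_ : Part → Part → Bool
inF  ==P inF  = true
cen  ==P cen  = true
outF ==P outF = true
_    ==P _    = false

-- the values 1 and -1 of the orientation function o
data Sign : Set where
  plus minus : Sign

-- A slice with center labels drawn from Λ.  Vertices are Fin nV, edges Fin nE.
-- Frontier vertices are labelled by inj₁ (a number), center vertices by inj₂.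
record Slice (Λ : Set) : Set where
  field
    nV nE : ℕ
    part  : Fin nV → Part
    src tgt : Fin nE → Fin nV
    o     : Fin nE → Sign
    lab   : Fin nV → ℕ ⊎ Λ
open Slice public

module _ {Λ : Set} (S : Slice Λ) where

  Inc : Fin (nE S) → Fin (nV S) → Set
  Inc e v = src S e ≡ v ⊎ tgt S e ≡ v

  IsFrontier : Fin (nV S) → Set
  IsFrontier v = part S v ≢ cen

  record WellFormed : Set where
    field
      frontier-one-edge : ∀ v → IsFrontier v →
        Σ (Fin (nE S)) λ e → Inc e v × (∀ e' → Inc e' v → e' ≡ e)
      not-both-in  : ∀ e → ¬ (part S (src S e) ≡ inF  × part S (tgt S e) ≡ inF)
      not-both-out : ∀ e → ¬ (part S (src S e) ≡ outF × part S (tgt S e) ≡ outF)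
      o-tgt-out : ∀ e → part S (tgt S e) ≡ outF → o S e ≡ plus
      o-tgt-in  : ∀ e → part S (tgt S e) ≡ inF  → o S e ≡ minus
      o-src-in  : ∀ e → part S (src S e) ≡ inF  → o S e ≡ plus
      o-src-out : ∀ e → part S (src S e) ≡ outF → o S e ≡ minus
      frontier-num : ∀ v → IsFrontier v → ∃ λ k → lab S v ≡ inj₁ k
      center-sym   : ∀ v → part S v ≡ cen → ∃ λ a → lab S v ≡ inj₂ a
      inj-in  : ∀ v w → part S v ≡ inF  → part S w ≡ inF  → lab S v ≡ lab S w → v ≡ w
      inj-out : ∀ v w → part S v ≡ outF → part S w ≡ outF → lab S v ≡ lab S w → v ≡ w

  sizeOf : Part → ℕ
  sizeOf p = count (nV S) (λ v → part S v ==P p)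

  record InSigma (c q : ℕ) : Set where
    field
      wf       : WellFormed
      unit     : sizeOf cen ≤ 1
      width-in  : sizeOf inF ≤ c
      width-out : sizeOf outF ≤ c
      nums-range : ∀ v k → lab S v ≡ inj₁ k → 1 ≤ k × k ≤ q

  Initial : Set
  Initial = ∀ v → part S v ≢ inF

  Final : Set
  Final = ∀ v → part S v ≢ outF

record Gluable {Λ : Set} (S₁ S₂ : Slice Λ) : Set where
  field
    same-numbers : ∀ k →
      (∃ λ v → part S₁ v ≡ outF × lab S₁ v ≡ inj₁ k) ⇔ (∃ λ w → part S₂ w ≡ inF × lab S₂ w ≡ inj₁ k)
    same-o : ∀ v w e₁ e₂ → part S₁ v ≡ outF → part S₂ w ≡ inF → lab S₁ v ≡ lab S₂ w →
      Inc S₁ e₁ v → Inc S₂ e₂ w → o S₁ e₁ ≡ o S₂ e₂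

FirstInitial : ∀ {Λ} → List (Slice Λ) → Set
FirstInitial []      = ⊥
FirstInitial (S ∷ _) = Initial S

LastFinal : ∀ {Λ} → List (Slice Λ) → Set
LastFinal []            = ⊥
LastFinal (S ∷ [])      = Final S
LastFinal (_ ∷ S ∷ w)   = LastFinal (S ∷ w)

-- a string S₁⋯Sₘ over Σ^{c,q}, S₁ initial, Sₘ final, Sᵢ gluable to Sᵢ₊₁
-- (permutation slices allowed, i.e. a possibly dilated unit decomposition)
record ValidString {Λ : Set} (c q : ℕ) (w : List (Slice Λ)) : Set where
  field
    letters : All (λ S → InSigma S c q) w
    first   : FirstInitial w
    last    : LastFinal w
    glue    : Linked Gluable w

IsSliceLanguage : ∀ {Λ} → ℕ → ℕ → (List (Slice Λ) → Set) → Set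
IsSliceLanguage c q L = ∀ w → L w → ValidString c q w

record Digraph (Λ : Set) : Set where
  field
    nV nE : ℕ
    src tgt : Fin nE → Fin nV
    lab : Fin nV → Λ

record Iso {Λ : Set} (H H' : Digraph Λ) : Set where
  private module H = Digraph H
  private module H' = Digraph H'
  field
    vmap : Fin H.nV ↔ Fin H'.nV
    emap : Fin H.nE ↔ Fin H'.nE
    src-pres : ∀ e → Inverse.to vmap (H.src e) ≡ H'.src (Inverse.to emap e)
    tgt-pres : ∀ e → Inverse.to vmap (H.tgt e) ≡ H'.tgt (Inverse.to emap e)
    lab-pres : ∀ v → H'.lab (Inverse.to vmap v) ≡ H.lab v

-- Vertices: the center vertices of all slices, listed in slice order
-- (within a slice by vertex index), encoded as (slice index, vertex index, label).
-- Edges: every fused edge is represented by its leftmost piece, an edge of some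
-- Sⱼ with both endpoints in the center, or one in the center and one in Oⱼ;
-- the other end is found by following matched frontier numbers to the right.

module Composition {Λ : Set} where

  centersOf : (S : Slice Λ) → ℕ → List (ℕ × ℕ × Λ)
  centersOf S j = mapMaybe pick (allFin (nV S))
    where
    pick : Fin (nV S) → Maybe (ℕ × ℕ × Λ)
    pick v with part S v | lab S v
    ... | cen | inj₂ a = just (j , toℕ v , a)
    ... | _   | _      = nothing

  gv : List (Slice Λ) → ℕ → List (ℕ × ℕ × Λ)
  gv []      j = []
  gv (S ∷ w) j = centersOf S j ++ gv w (suc j)

  isNum : ℕ → ℕ ⊎ Λ → Bool
  isNum k (inj₁ k') = k ≡ᵇ k'
  isNum k (inj₂ _)  = false

  other : (S : Slice Λ) → Fin (nE S) → Fin (nV S) → Fin (nV S)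
  other S e v = if src S e ==F v then tgt S e else src S e

  -- entering slice number j (the head of the list) through the in-frontier
  -- vertex numbered k, follow the edge until a center vertex is reached
  trace : List (Slice Λ) → ℕ → ℕ → Maybe (ℕ × ℕ)
  trace []      j k = nothing
  trace (S ∷ w) j k with findFin (nV S) (λ v → (part S v ==P inF) ∧ isNum k (lab S v))
  ... | nothing = nothing
  ... | just x with findFin (nE S) (λ e → (src S e ==F x) Data.Bool.∨ (tgt S e ==F x))
  ...   | nothing = nothing
  ...   | just e with part S (other S e x) | lab S (other S e x)
  ...     | cen  | _        = just (j , toℕ (other S e x))
  ...     | outF | inj₁ k'  = trace w (suc j) k'
  ...     | _    | _        = nothing

  edgeCand : (S : Slice Λ) → List (Slice Λ) → ℕ → Fin (nE S) → Maybe ((ℕ × ℕ) × (ℕ × ℕ))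
  edgeCand S w j e with part S (src S e) | part S (tgt S e) | lab S (src S e) | lab S (tgt S e)
  ... | cen  | cen  | _       | _       = just ((j , toℕ (src S e)) , (j , toℕ (tgt S e)))
  ... | cen  | outF | _       | inj₁ k  = trace w (suc j) k >>= λ y → just ((j , toℕ (src S e)) , y)
  ... | outF | cen  | inj₁ k  | _       = trace w (suc j) k >>= λ y → just (y , (j , toℕ (tgt S e)))
  ... | _    | _    | _       | _       = nothing

  cands : List (Slice Λ) → ℕ → List ((ℕ × ℕ) × (ℕ × ℕ))
  cands []      j = []
  cands (S ∷ w) j = mapMaybe (edgeCand S w j) (allFin (nE S)) ++ cands w (suc j)

  verts : List (Slice Λ) → List (ℕ × ℕ × Λ)
  verts w = gv w 0

  idx : (w : List (Slice Λ)) → ℕ × ℕ → Maybe (Fin (length (verts w)))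
  idx w (j , v) = findIndexᵇ (λ { (j' , v' , _) → (j ≡ᵇ j') ∧ (v ≡ᵇ v') }) (verts w)

  edges : (w : List (Slice Λ)) → List (Fin (length (verts w)) × Fin (length (verts w)))
  edges w = mapMaybe resolve (cands w 0)
    where
    resolve : (ℕ × ℕ) × (ℕ × ℕ) → Maybe (Fin (length (verts w)) × Fin (length (verts w)))
    resolve (x , y) = idx w x >>= λ i → idx w y >>= λ i' → just (i , i')

  compose : List (Slice Λ) → Digraph Λ
  compose w = record
    { nV  = length (verts w)
    ; nE  = length (edges w)
    ; src = λ e → proj₁ (lookup (edges w) e)
    ; tgt = λ e → proj₂ (lookup (edges w) e)
    ; lab = λ i → proj₂ (proj₂ (lookup (verts w) i))
    }

open Composition public using (compose)

-- an ordering (v₁,…,vₙ) of the vertices: position i ↦ vᵢ (Inverse.to), bijective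
Ordering : ∀ {Λ} → Digraph Λ → Set
Ordering H = Fin (Digraph.nV H) ↔ Fin (Digraph.nV H)

record SimplePath {Λ : Set} (H : Digraph Λ) : Set where
  private module H = Digraph H
  field
    len : ℕ
    vs  : Fin (suc len) → Fin H.nV
    es  : Fin len → Fin H.nE
    es-src : ∀ i → H.src (es i) ≡ vs (Data.Fin.inject₁ i)
    es-tgt : ∀ i → H.tgt (es i) ≡ vs (suc i)
    distinct : ∀ i j → vs i ≡ vs j → i ≡ j

crosses : ∀ {Λ} (H : Digraph Λ) → Ordering H → ℕ → Fin (Digraph.nE H) → Bool
crosses H ω i e =
  (toℕ (Inverse.from ω (Digraph.src H e)) <ᵇ i) xor (toℕ (Inverse.from ω (Digraph.tgt H e)) <ᵇ i)

ZTopological : ∀ {Λ} (H : Digraph Λ) → ℕ → Ordering H → Set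
ZTopological H z ω = ∀ (p : SimplePath H) (i : ℕ) →
  count (SimplePath.len p) (λ j → crosses H ω i (SimplePath.es p j)) ≤ z

-- vertex i of compose w is the i-th center vertex in slice order, so a
-- decomposition w of H (via φ : compose w ≅ H) is compatible with ω iff
-- φ maps the i-th center vertex to vᵢ, i.e. its position under ω is i
-- (positions compared as naturals since the two index types are only
-- propositionally equal).
Compatible : ∀ {Λ} {w : List (Slice Λ)} {H : Digraph Λ} → Iso (compose w) H → Ordering H → Set
Compatible φ ω = ∀ i → toℕ (Inverse.from ω (Inverse.to (Iso.vmap φ) i)) ≡ toℕ i

-- zig-zag number of the string w is at most z: w (a decomposition of its own
-- composition) is compatible with some z-topological ordering of compose w
ZigZagAtMost : ∀ {Λ} → List (Slice Λ) → ℕ → Set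
ZigZagAtMost w z = Σ (Ordering (compose w)) λ ω → ZTopological (compose w) z ω × (∀ i → Inverse.to ω i ≡ i)

HasZigZagNumber : ∀ {Λ} → (List (Slice Λ) → Set) → ℕ → Set
HasZigZagNumber L z = (∀ w → L w → ZigZagAtMost w z) × (∀ z' → (∀ w → L w → ZigZagAtMost w z') → z ≤ z')

InGraphLang : ∀ {Λ} → (List (Slice Λ) → Set) → Digraph Λ → Set
InGraphLang L H = Σ (List (Slice _)) λ w → L w × Iso (compose w) H

record DilatedSaturated {Λ : Set} (c q z : ℕ) (L : List (Slice Λ) → Set) : Set₁ where
  field
    zigzag-bound : ∀ w → L w → ZigZagAtMost w z
    saturated : ∀ (H : Digraph Λ) → InGraphLang L H → (ω : Ordering H) → ZTopological H z ω →
      ∀ w → ValidString c q w → (φ : Iso (compose w) H) → Compatible {w = w} φ ω → L w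

module Submission where

-- The inclusion L^∩_G ⊆ L_G ∩ L'_G is immediate: a string of
-- both languages witnesses membership in both graph languages.  For the
-- converse, let H ≅ compose w with w ∈ L and H ≅ compose w' with w' ∈ L'.
-- Since L has zig-zag number z, w is compatible with a z-topological
-- ordering ω of its own composition (ω lists the center vertices in slice
-- order).  As compose w ≅ compose w' lies in L'_G and L' is z-dilated-
-- saturated, the decomposition w of compose w, compatible with ω, belongs
-- to L'; hence w ∈ L ∩ L' and H ∈ L^∩_G.

open import Defs
open import Data.Nat using (ℕ)
open import Data.Fin using (Fin; toℕ)
open import Data.List using (List)
open import Data.Product using (_×_; _,_)
open import Function.Bundles using (_⇔_; mk⇔; Inverse)
open import Function.Properties.Inverse using (↔-sym; ↔-trans; ↔-refl)
open import Relation.Binary.PropositionalEquality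
  using (_≡_; refl; sym; trans; cong; module ≡-Reasoning)

open Inverse

isoRefl : ∀ {Λ} (H : Digraph Λ) → Iso H H
isoRefl H = record
  { vmap = ↔-refl ; emap = ↔-refl
  ; src-pres = λ _ → refl ; tgt-pres = λ _ → refl ; lab-pres = λ _ → refl }

isoTrans : ∀ {Λ} {H₁ H₂ H₃ : Digraph Λ} → Iso H₁ H₂ → Iso H₂ H₃ → Iso H₁ H₃
isoTrans φ ψ = record
  { vmap = ↔-trans (Iso.vmap φ) (Iso.vmap ψ)
  ; emap = ↔-trans (Iso.emap φ) (Iso.emap ψ)
  ; src-pres = λ e → trans (cong (to (Iso.vmap ψ)) (Iso.src-pres φ e)) (Iso.src-pres ψ _)
  ; tgt-pres = λ e → trans (cong (to (Iso.vmap ψ)) (Iso.tgt-pres φ e)) (Iso.tgt-pres ψ _)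
  ; lab-pres = λ v → trans (Iso.lab-pres ψ _) (Iso.lab-pres φ v)
  }

isoSym : ∀ {Λ} {H H' : Digraph Λ} → Iso H H' → Iso H' H
isoSym {H = H} {H'} φ = record
  { vmap = ↔-sym V ; emap = ↔-sym E
  ; src-pres = endpoint-pres (Digraph.src H) (Digraph.src H') (Iso.src-pres φ)
  ; tgt-pres = endpoint-pres (Digraph.tgt H) (Digraph.tgt H') (Iso.tgt-pres φ)
  ; lab-pres = λ v → begin
      Digraph.lab H (from V v)          ≡⟨ sym (Iso.lab-pres φ (from V v)) ⟩
      Digraph.lab H' (to V (from V v))  ≡⟨ cong (Digraph.lab H') (strictlyInverseˡ V v) ⟩
      Digraph.lab H' v                  ∎
  }
  where
  open ≡-Reasoning
  V = Iso.vmap φ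
  E = Iso.emap φ

  endpoint-pres : (f : Fin (Digraph.nE H) → Fin (Digraph.nV H))
                  (f' : Fin (Digraph.nE H') → Fin (Digraph.nV H')) →
                  (∀ e → to V (f e) ≡ f' (to E e)) →
                  ∀ e → from V (f' e) ≡ f (from E e)
  endpoint-pres f f' pres e = begin
    from V (f' e)                 ≡⟨ cong (λ e' → from V (f' e')) (sym (strictlyInverseˡ E e)) ⟩
    from V (f' (to E (from E e))) ≡⟨ cong (from V) (sym (pres (from E e))) ⟩
    from V (to V (f (from E e)))  ≡⟨ strictlyInverseʳ V (f (from E e)) ⟩
    f (from E e)                  ∎

fixed-ordering-compatible : ∀ {Λ} (w : List (Slice Λ)) (ω : Ordering (compose w)) →
  (∀ i → to ω i ≡ i) → Compatible {w = w} (isoRefl (compose w)) ω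
fixed-ordering-compatible w ω fixes i = cong toℕ (begin
  from ω i          ≡⟨ cong (from ω) (sym (fixes i)) ⟩
  from ω (to ω i)   ≡⟨ strictlyInverseʳ ω i ⟩
  i                 ∎)
  where open ≡-Reasoning

saturated-contains : ∀ {Λ} {c q z : ℕ} {L' : List (Slice Λ) → Set} →
  DilatedSaturated c q z L' →
  (w : List (Slice Λ)) → ValidString c q w → ZigZagAtMost w z →
  InGraphLang L' (compose w) → L' w
saturated-contains ds w valid (ω , ztop , fixes) inL'G =
  DilatedSaturated.saturated ds (compose w) inL'G ω ztop w valid
    (isoRefl (compose w)) (fixed-ordering-compatible w ω fixes)

proposition2 : {Λ : Set} (c q z : ℕ) (L L' : List (Slice Λ) → Set) →
    IsSliceLanguage c q L → IsSliceLanguage c q L' →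
    HasZigZagNumber L z → DilatedSaturated c q z L' →
    (H : Digraph Λ) →
    InGraphLang (λ w → L w × L' w) H ⇔ (InGraphLang L H × InGraphLang L' H)
proposition2 c q z L L' sliceL _ (zigzagL , _) saturatedL' H = mk⇔ split merge
  where
  split : InGraphLang (λ w → L w × L' w) H → InGraphLang L H × InGraphLang L' H
  split (w , (inL , inL') , φ) = (w , inL , φ) , (w , inL' , φ)

  -- The decomposition w ∈ L of H is also in L', since
  -- compose w ≅ H ≅ compose w' with w' ∈ L'.
  merge : InGraphLang L H × InGraphLang L' H → InGraphLang (λ w → L w × L' w) H
  merge ((w , inL , φ) , (w' , inL' , φ')) = w , (inL , w∈L') , φ
    where
    w∈L' : L' w
    w∈L' = saturated-contains saturatedL' w (sliceL w inL) (zigzagL w inL)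
             (w' , inL' , isoTrans φ' (isoSym φ))
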